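{- Let $c\in\mathbb{L}$, let $A\subseteq\mathbb{L}\setminus\{c\}$ be $c$-universal, and let $f\colon\mathbb{L}\to\mathbb{L}$ behave as $\widetilde{\mathrm{rer}}_c$ on $A$. Then $f$ preserves $Q$ on $A$.
   Context: A finite rooted binary tree is a finite rooted tree in which every non-leaf vertex has exactly two children; its leaf structure is the structure on its set of leaves with the ternary relation $C$ where $C(x;yz)$ holds iff the youngest common ancestor of $y$ and $z$ is a proper descendant of the youngest common ancestor of $x,y,z$ (so $C(x;yy)$ holds whenever $x\neq y$). $(\mathbb{L};C)$ denotes the unique (up to isomorphism) countable homogeneous structure whose finite substructures are, up to isomorphism, exactly the leaf structures of finite rooted binary trees. We write $xy|z$ for $C(z;xy)$; $a_1\dots a_m|b_1\dots b_n$ (resp. $Y|Z$ for sets) means $a_ia_j|b_k$ and $b_kb_l|a_i$ for all $i,j,k,l$ (resp. all choices from $Y,Z$). $Q$ is the quaternary relation $xy:uv\iff(xy|u\wedge xy|v)\vee(x|uv\wedge y|uv)$; $f$ preserves $Q$ on $Y$ if $a_1a_2:a_3a_4$ implies $f(a_1)f(a_2):f(a_3)f(a_4)$ for all $a_i\in Y$. A set $A\subseteq\mathbb{L}\setminus\{c\}$ is $c$-universal if for every finite $U\subset\mathbb{L}$ and $u\in U$ there is $\alpha\in\mathrm{Aut}(\mathbb{L};C)$ with $\alpha(u)=c$ and $\alpha(U)\subseteq A\cup\{c\}$. For $x\neq c$, $S^c_x=\{y\in\mathbb{L}\setminus\{c\}:xy|c\}$. $e$ preserves $C$ on $B$ if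 $C(x;yz)$ implies $C(e(x);e(y)e(z))$ for $x,y,z\in B$. $e$ behaves as $\widetilde{\mathrm{rer}}_c$ on $A$ if (1) $e(c)|e(A\cap S^c_a)$ for every $a\in A$, (2) $e$ preserves $C$ on $A\cap S^c_a$ for every $a\in A$, (3) for all $a,b\in A$ either $S^c_a=S^c_b$ or $e(A\cap S^c_a)|e(A\cap S^c_b)$, and (4) for all $x,y\in A$ with $x|yc$ we have $e(y)|e(x)e(c)$. -}

module Defs where

open import Data.Nat using (ℕ; suc; _+_)
open import Data.Fin using (Fin; splitAt)
open import Data.Sum using (_⊎_; inj₁; inj₂)
open import Data.Product using (Σ; _×_; _,_)
open import Data.Empty using (⊥)
open import Data.Unit using (⊤)
open import Relation.Binary.PropositionalEquality using (_≡_; _≢_)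

_⟺_ : Set → Set → Set
P ⟺ Q = (P → Q) × (Q → P)

-- Finite rooted binary trees, indexed by their number of leaves;
-- leaves are labelled by Fin n, left to right.
data BTree : ℕ → Set where
  leaf : BTree 1
  node : ∀ {m n} → BTree m → BTree n → BTree (m + n)

-- Leaf structure: leafC T x y z  means  C(x;yz) in T, i.e. the youngest common
-- ancestor of y,z is a proper descendant of the youngest common ancestor of x,y,z.
mutual
  leafC : ∀ {n} → BTree n → Fin n → Fin n → Fin n → Set
  leafC leaf x y z = ⊥
  leafC (node {m} l r) x y z = nodeC l r (splitAt m x) (splitAt m y) (splitAt m z)

  nodeC : ∀ {m n} → BTree m → BTree n →
          Fin m ⊎ Fin n → Fin m ⊎ Fin n → Fin m ⊎ Fin n → Set
  nodeC l r (inj₁ x) (inj₁ y) (inj₁ z) = leafC l x y z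
  nodeC l r (inj₂ x) (inj₂ y) (inj₂ z) = leafC r x y z
  nodeC l r (inj₂ x) (inj₁ y) (inj₁ z) = ⊤
  nodeC l r (inj₁ x) (inj₂ y) (inj₂ z) = ⊤
  nodeC l r _ _ _ = ⊥

InjectiveMap : ∀ {n} {L : Set} → (Fin n → L) → Set
InjectiveMap g = ∀ i j → g i ≡ g j → i ≡ j

record Aut (L : Set) (C : L → L → L → Set) : Set where
  field
    fun      : L → L
    inv      : L → L
    inv-fun  : ∀ x → inv (fun x) ≡ x
    fun-inv  : ∀ x → fun (inv x) ≡ x
    preserve : ∀ x y z → C x y z ⟺ C (fun x) (fun y) (fun z)
open Aut public

-- C x y z  reads  C(x;yz).
record IsLStructure (L : Set) (C : L → L → L → Set) : Set₁ where
  field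
    countable   : Σ (ℕ → L) (λ e → ∀ x → Σ ℕ (λ k → e k ≡ x))
    age-sub     : ∀ n (g : Fin (suc n) → L) → InjectiveMap g →
                  Σ (BTree (suc n)) λ T → Σ (Fin (suc n) → Fin (suc n)) λ π →
                    InjectiveMap π ×
                    (∀ i j k → C (g i) (g j) (g k) ⟺ leafC T (π i) (π j) (π k))
    age-sup     : ∀ n (T : BTree n) → Σ (Fin n → L) λ g → InjectiveMap g ×
                    (∀ i j k → C (g i) (g j) (g k) ⟺ leafC T i j k)
    homogeneous : ∀ n (g h : Fin n → L) → InjectiveMap g → InjectiveMap h →
                  (∀ i j k → C (g i) (g j) (g k) ⟺ C (h i) (h j) (h k)) →
                  Σ (Aut L C) λ α → ∀ i → fun α (g i) ≡ h i

module LNotions {L : Set} (C : L → L → L → Set) where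

  Q : L → L → L → L → Set
  Q x y u v = (C u x y × C v x y) ⊎ (C x u v × C y u v)

  PreservesQOn : (L → Set) → (L → L) → Set
  PreservesQOn Y f = ∀ a₁ a₂ a₃ a₄ → Y a₁ → Y a₂ → Y a₃ → Y a₄ →
                     Q a₁ a₂ a₃ a₄ → Q (f a₁) (f a₂) (f a₃) (f a₄)

  -- A ⊆ L ∖ {c} and A is c-universal (finite sets U given as images of Fin n)
  Universal : L → (L → Set) → Set
  Universal c A =
    (∀ x → A x → x ≢ c) ×
    (∀ n (U : Fin n → L) (i : Fin n) →
       Σ (Aut L C) λ α → (fun α (U i) ≡ c) × (∀ j → A (fun α (U j)) ⊎ fun α (U j) ≡ c))

  S : L → L → L → Set
  S c x y = y ≢ c × C c x y

  Sep : (L → Set) → (L → Set) → Set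
  Sep Y Z = (∀ y y′ z → Y y → Y y′ → Z z → C z y y′) ×
            (∀ y z z′ → Y y → Z z → Z z′ → C y z z′)

  Img : (L → L) → (L → Set) → L → Set
  Img e Y w = Σ L λ y → Y y × e y ≡ w

  AS : (L → Set) → L → L → L → Set
  AS A c a y = A y × S c a y

  BehavesAsRer : L → (L → Set) → (L → L) → Set
  BehavesAsRer c A e =
    (∀ a → A a → Sep (λ w → w ≡ e c) (Img e (AS A c a))) ×
    (∀ a → A a → ∀ x y z → AS A c a x → AS A c a y → AS A c a z →
       C x y z → C (e x) (e y) (e z)) ×
    (∀ a b → A a → A b →
       (∀ y → S c a y ⟺ S c b y) ⊎ Sep (Img e (AS A c a)) (Img e (AS A c b))) ×
    (∀ x y → A x → A y → C x y c → C (e y) (e x) (e c))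

-- Every finite substructure of (L; C) is a leaf structure, so C satisfies the
-- axioms of a C-relation (symmetry in the last two places, asymmetry, the
-- diagonal law and the four-point split law), which are checked on trees.
-- For a triple yz|x in A, place c: if yz|c then y and z lie in the same
-- cluster S^c_y, and conditions (1)–(3) give f(y)f(z)|f(x) and f(y)f(z)|f(c);
-- otherwise x|yc and x|zc, and condition (4) gives f(y)|f(x)f(c) and
-- f(z)|f(x)f(c).  Either way f(y)f(z):f(x)f(c).  A Q-quadruple ab:uv consists
-- of two such triples sharing a pair, and xy:ur, xy:vr imply xy:uv.
module Submission where

open import Defs
open import Data.Nat using (ℕ)
import Data.Nat as ℕ
open import Data.Fin using (Fin; zero; splitAt; join)
open import Data.Fin.Patterns using (0F; 1F; 2F; 3F)
open import Data.Fin.Properties using (join-splitAt)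
open import Data.Vec using ([]; _∷_; lookup)
open import Data.Vec.Relation.Unary.All using ([]; _∷_)
open import Data.Vec.Relation.Unary.AllPairs using ([]; _∷_)
open import Data.Vec.Relation.Unary.Unique.Propositional.Properties using (lookup-injective)
open import Data.Sum using (_⊎_; inj₁; inj₂)
open import Data.Product using (_,_; proj₁; proj₂)
open import Data.Empty using (⊥-elim)
open import Data.Unit using (tt)
open import Relation.Nullary using (Dec; yes; no; ¬_)
open import Relation.Binary.PropositionalEquality

splitAt-injective : ∀ m {n} {i j : Fin (m ℕ.+ n)} → splitAt m i ≡ splitAt m j → i ≡ j
splitAt-injective m {n} {i} {j} eq = begin
  i                      ≡⟨ join-splitAt m n i ⟨
  join m n (splitAt m i) ≡⟨ cong (join m n) eq ⟩
  join m n (splitAt m j) ≡⟨ join-splitAt m n j ⟩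
  j                      ∎
  where open ≡-Reasoning

mutual
  leafC-swap : ∀ {n} (T : BTree n) x y z → leafC T x y z → leafC T x z y
  leafC-swap (node {m} l r) x y z = nodeC-swap l r (splitAt m x) (splitAt m y) (splitAt m z)

  nodeC-swap : ∀ {m n} (l : BTree m) (r : BTree n) a b c → nodeC l r a b c → nodeC l r a c b
  nodeC-swap l r (inj₁ x) (inj₁ y) (inj₁ z) h = leafC-swap l x y z h
  nodeC-swap l r (inj₂ x) (inj₂ y) (inj₂ z) h = leafC-swap r x y z h
  nodeC-swap l r (inj₂ x) (inj₁ y) (inj₁ z) h = tt
  nodeC-swap l r (inj₁ x) (inj₂ y) (inj₂ z) h = tt
  nodeC-swap l r (inj₁ x) (inj₁ y) (inj₂ z) ()
  nodeC-swap l r (inj₁ x) (inj₂ y) (inj₁ z) ()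
  nodeC-swap l r (inj₂ x) (inj₁ y) (inj₂ z) ()
  nodeC-swap l r (inj₂ x) (inj₂ y) (inj₁ z) ()

mutual
  leafC-asym : ∀ {n} (T : BTree n) x y z → leafC T x y z → ¬ leafC T y x z
  leafC-asym (node {m} l r) x y z = nodeC-asym l r (splitAt m x) (splitAt m y) (splitAt m z)

  nodeC-asym : ∀ {m n} (l : BTree m) (r : BTree n) a b c → nodeC l r a b c → ¬ nodeC l r b a c
  nodeC-asym l r (inj₁ x) (inj₁ y) (inj₁ z) h = leafC-asym l x y z h
  nodeC-asym l r (inj₂ x) (inj₂ y) (inj₂ z) h = leafC-asym r x y z h
  nodeC-asym l r (inj₂ x) (inj₁ y) (inj₁ z) h ()
  nodeC-asym l r (inj₁ x) (inj₂ y) (inj₂ z) h ()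
  nodeC-asym l r (inj₁ x) (inj₁ y) (inj₂ z) ()
  nodeC-asym l r (inj₁ x) (inj₂ y) (inj₁ z) ()
  nodeC-asym l r (inj₂ x) (inj₁ y) (inj₂ z) ()
  nodeC-asym l r (inj₂ x) (inj₂ y) (inj₁ z) ()

leafC-irrefl : ∀ {n} (T : BTree n) x z → ¬ leafC T x x z
leafC-irrefl T x z h = leafC-asym T x x z h h

mutual
  leafC-diag : ∀ {n} (T : BTree n) x y → x ≢ y → leafC T x y y
  leafC-diag leaf zero zero x≢y = ⊥-elim (x≢y refl)
  leafC-diag (node {m} l r) x y x≢y =
    nodeC-diag l r (splitAt m x) (splitAt m y) (λ eq → x≢y (splitAt-injective m eq))

  nodeC-diag : ∀ {m n} (l : BTree m) (r : BTree n) a b → a ≢ b → nodeC l r a b b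
  nodeC-diag l r (inj₁ x) (inj₁ y) a≢b = leafC-diag l x y (λ eq → a≢b (cong inj₁ eq))
  nodeC-diag l r (inj₂ x) (inj₂ y) a≢b = leafC-diag r x y (λ eq → a≢b (cong inj₂ eq))
  nodeC-diag l r (inj₁ x) (inj₂ y) a≢b = tt
  nodeC-diag l r (inj₂ x) (inj₁ y) a≢b = tt

mutual
  leafC-split : ∀ {n} (T : BTree n) x y z w → leafC T x y z → leafC T x w z ⊎ leafC T w y z
  leafC-split (node {m} l r) x y z w =
    nodeC-split l r (splitAt m x) (splitAt m y) (splitAt m z) (splitAt m w)

  nodeC-split : ∀ {m n} (l : BTree m) (r : BTree n) a b c d → nodeC l r a b c →
                nodeC l r a d c ⊎ nodeC l r d b c
  nodeC-split l r (inj₁ x) (inj₁ y) (inj₁ z) (inj₁ w) h = leafC-split l x y z w h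
  nodeC-split l r (inj₁ x) (inj₁ y) (inj₁ z) (inj₂ w) h = inj₂ tt
  nodeC-split l r (inj₂ x) (inj₂ y) (inj₂ z) (inj₂ w) h = leafC-split r x y z w h
  nodeC-split l r (inj₂ x) (inj₂ y) (inj₂ z) (inj₁ w) h = inj₂ tt
  nodeC-split l r (inj₂ x) (inj₁ y) (inj₁ z) (inj₁ w) h = inj₁ tt
  nodeC-split l r (inj₂ x) (inj₁ y) (inj₁ z) (inj₂ w) h = inj₂ tt
  nodeC-split l r (inj₁ x) (inj₂ y) (inj₂ z) (inj₂ w) h = inj₁ tt
  nodeC-split l r (inj₁ x) (inj₂ y) (inj₂ z) (inj₁ w) h = inj₂ tt
  nodeC-split l r (inj₁ x) (inj₁ y) (inj₂ z) w ()
  nodeC-split l r (inj₁ x) (inj₂ y) (inj₁ z) w ()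
  nodeC-split l r (inj₂ x) (inj₁ y) (inj₂ z) w ()
  nodeC-split l r (inj₂ x) (inj₂ y) (inj₁ z) w ()

module CRelation {L : Set} {C : L → L → L → Set} (isL : IsLStructure L C) where
  open IsLStructure isL

  private
    enum : ℕ → L
    enum = proj₁ countable

    index : L → ℕ
    index x = proj₁ (proj₂ countable x)

    enum-index : ∀ x → enum (index x) ≡ x
    enum-index x = proj₂ (proj₂ countable x)

  _≟_ : (x y : L) → Dec (x ≡ y)
  x ≟ y with index x ℕ.≟ index y
  ... | yes same = yes (begin
          x               ≡⟨ enum-index x ⟨
          enum (index x) ≡⟨ cong enum same ⟩
          enum (index y) ≡⟨ enum-index y ⟩
          y               ∎)
    where open ≡-Reasoning
  ... | no differ = no (λ x≡y → differ (cong index x≡y))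

  C-irrefl : ∀ {x} → ¬ C x x x
  C-irrefl {x} h with age-sub 0 (lookup (x ∷ [])) (lookup-injective ([] ∷ []))
  ... | T , π , _ , iff = leafC-irrefl T _ _ (proj₁ (iff 0F 0F 0F) h)

  C-irreflˡ : ∀ {x z} → ¬ C x x z
  C-irreflˡ {x} {z} h with x ≟ z
  ... | yes refl = C-irrefl h
  ... | no x≢z with age-sub 1 (lookup (x ∷ z ∷ [])) (lookup-injective ((x≢z ∷ []) ∷ [] ∷ []))
  ...   | T , π , _ , iff = leafC-irrefl T _ _ (proj₁ (iff 0F 0F 1F) h)

  C-irreflʳ : ∀ {x z} → ¬ C x z x
  C-irreflʳ {x} {z} h with x ≟ z
  ... | yes refl = C-irrefl h
  ... | no x≢z with age-sub 1 (lookup (x ∷ z ∷ [])) (lookup-injective ((x≢z ∷ []) ∷ [] ∷ []))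
  ...   | T , π , _ , iff = leafC-irrefl T _ _ (leafC-swap T _ _ _ (proj₁ (iff 0F 1F 0F) h))

  C-distinct₁₂ : ∀ {x y z} → C x y z → x ≢ y
  C-distinct₁₂ h refl = C-irreflˡ h

  C-distinct₁₃ : ∀ {x y z} → C x y z → x ≢ z
  C-distinct₁₃ h refl = C-irreflʳ h

  C-swap : ∀ {x y z} → C x y z → C x z y
  C-swap {x} {y} {z} h with y ≟ z
  ... | yes refl = h
  ... | no y≢z with age-sub 2 (lookup (x ∷ y ∷ z ∷ []))
                      (lookup-injective ((C-distinct₁₂ h ∷ C-distinct₁₃ h ∷ []) ∷ (y≢z ∷ []) ∷ [] ∷ []))
  ...   | T , π , _ , iff = proj₂ (iff 0F 2F 1F) (leafC-swap T _ _ _ (proj₁ (iff 0F 1F 2F) h))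

  C-asym : ∀ {x y z} → C x y z → ¬ C y x z
  C-asym {x} {y} {z} h h′ with age-sub 2 (lookup (x ∷ y ∷ z ∷ []))
         (lookup-injective ((C-distinct₁₂ h ∷ C-distinct₁₃ h ∷ []) ∷ (C-distinct₁₃ h′ ∷ []) ∷ [] ∷ []))
  ... | T , π , _ , iff = leafC-asym T _ _ _ (proj₁ (iff 0F 1F 2F) h) (proj₁ (iff 1F 0F 2F) h′)

  C-diag : ∀ {x y} → x ≢ y → C x y y
  C-diag {x} {y} x≢y with age-sub 1 (lookup (x ∷ y ∷ [])) (lookup-injective ((x≢y ∷ []) ∷ [] ∷ []))
  ... | T , π , π-injective , iff =
    proj₂ (iff 0F 1F 1F) (leafC-diag T _ _ (λ eq → x≢y (cong (lookup (x ∷ y ∷ [])) (π-injective 0F 1F eq))))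

  C-split : ∀ {x y z} w → C x y z → C x w z ⊎ C w y z
  C-split {x} {y} {z} w h with w ≟ x | w ≟ y | w ≟ z | y ≟ z
  ... | yes refl | _        | _        | _        = inj₂ h
  ... | no _     | yes refl | _        | _        = inj₁ h
  ... | no _     | no _     | yes refl | _        = inj₁ (C-diag (C-distinct₁₃ h))
  ... | no _     | no w≢y   | no _     | yes refl = inj₂ (C-diag w≢y)
  ... | no w≢x   | no w≢y   | no w≢z   | no y≢z
      with age-sub 3 (lookup (x ∷ y ∷ z ∷ w ∷ []))
             (lookup-injective ((C-distinct₁₂ h ∷ C-distinct₁₃ h ∷ ≢-sym w≢x ∷ [])
                                ∷ (y≢z ∷ ≢-sym w≢y ∷ []) ∷ (≢-sym w≢z ∷ []) ∷ [] ∷ []))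
  ...   | T , π , _ , iff with leafC-split T _ _ _ (π 3F) (proj₁ (iff 0F 1F 2F) h)
  ...     | inj₁ k = inj₁ (proj₂ (iff 0F 3F 2F) k)
  ...     | inj₂ k = inj₂ (proj₂ (iff 3F 1F 2F) k)

  open LNotions C

  C-replace : ∀ {x y r v} → C r x y → C x v r → C v x y
  C-replace rxy xvr with C-split _ (C-swap rxy)
  ... | inj₂ vyx = C-swap vyx
  ... | inj₁ rvx = ⊥-elim (C-asym (C-swap xvr) (C-swap rvx))

  C-join : ∀ {x u v r} → C x u r → C x v r → C x u v
  C-join xur xvr with C-split _ (C-swap xur)
  ... | inj₁ xvu = C-swap xvu
  ... | inj₂ vru with C-split _ (C-swap xvr)
  ...   | inj₁ xuv = xuv
  ...   | inj₂ urv = ⊥-elim (C-asym (C-swap vru) (C-swap urv))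

  Q-via : ∀ {x y u v r} → Q x y u r → Q x y v r → Q x y u v
  Q-via (inj₁ (uxy , rxy)) (inj₁ (vxy , _))   = inj₁ (uxy , vxy)
  Q-via (inj₁ (uxy , rxy)) (inj₂ (xvr , _))   = inj₁ (uxy , C-replace rxy xvr)
  Q-via (inj₂ (xur , _))   (inj₁ (vxy , rxy)) = inj₁ (C-replace rxy xur , vxy)
  Q-via (inj₂ (xur , yur)) (inj₂ (xvr , yvr)) = inj₂ (C-join xur xvr , C-join yur yvr)

  Q-sym : ∀ {x y u v} → Q x y u v → Q u v x y
  Q-sym (inj₁ p) = inj₂ p
  Q-sym (inj₂ p) = inj₁ p

module Rerouting {L : Set} {C : L → L → L → Set} (isL : IsLStructure L C)
                 (c : L) (A : L → Set) (f : L → L) (c∉A : ∀ x → A x → x ≢ c)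
                 (rer : LNotions.BehavesAsRer C c A f) where
  open CRelation isL
  open LNotions C

  private
    c-apart-from-clusters = proj₁ rer
    preserves-C-in-cluster = proj₁ (proj₂ rer)
    clusters-equal-or-apart = proj₁ (proj₂ (proj₂ rer))
    reverses-outside = proj₂ (proj₂ (proj₂ rer))

  in-own-cluster : ∀ {y} → A y → AS A c y y
  in-own-cluster Ay = Ay , c∉A _ Ay , C-diag (≢-sym (c∉A _ Ay))

  in-cluster : ∀ {y z} → A z → C c y z → AS A c y z
  in-cluster Az cyz = Az , c∉A _ Az , cyz

  image-cluster-apart-from-c : ∀ {y z} → A y → A z → C c y z → C (f c) (f y) (f z)
  image-cluster-apart-from-c {y} {z} Ay Az cyz =
    proj₂ (c-apart-from-clusters y Ay) (f c) (f y) (f z) refl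
          (y , in-own-cluster Ay , refl) (z , in-cluster Az cyz , refl)

  image-preserves-C-at-cluster : ∀ {x y z} → A x → A y → A z → C x y z → C c y z →
                                 C (f x) (f y) (f z)
  image-preserves-C-at-cluster {x} {y} {z} Ax Ay Az xyz cyz with clusters-equal-or-apart x y Ax Ay
  ... | inj₁ same-cluster =
    preserves-C-in-cluster x Ax x y z (in-own-cluster Ax)
      (Ay , proj₂ (same-cluster y) (proj₂ (in-own-cluster Ay)))
      (Az , proj₂ (same-cluster z) (proj₂ (in-cluster Az cyz))) xyz
  ... | inj₂ apart =
    proj₂ apart (f x) (f y) (f z) (x , in-own-cluster Ax , refl)
          (y , in-own-cluster Ay , refl) (z , in-cluster Az cyz , refl)

  image-triple : ∀ {x y z} → A x → A y → A z → C x y z → Q (f y) (f z) (f x) (f c)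
  image-triple Ax Ay Az xyz with C-split c xyz | C-split c (C-swap xyz)
  ... | inj₂ cyz | _        = inj₁ (image-preserves-C-at-cluster Ax Ay Az xyz cyz ,
                                    image-cluster-apart-from-c Ay Az cyz)
  ... | inj₁ _   | inj₂ czy = inj₁ (image-preserves-C-at-cluster Ax Ay Az xyz (C-swap czy) ,
                                    image-cluster-apart-from-c Ay Az (C-swap czy))
  ... | inj₁ xcz | inj₁ xcy = inj₂ (reverses-outside _ _ Ax Ay (C-swap xcy) ,
                                    reverses-outside _ _ Ax Az (C-swap xcz))

  preserves-Q : PreservesQOn A f
  preserves-Q _ _ _ _ A₁ A₂ A₃ A₄ (inj₁ (c₃ , c₄)) =
    Q-via (image-triple A₃ A₁ A₂ c₃) (image-triple A₄ A₁ A₂ c₄)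
  preserves-Q _ _ _ _ A₁ A₂ A₃ A₄ (inj₂ (c₁ , c₂)) =
    Q-sym (Q-via (image-triple A₁ A₃ A₄ c₁) (image-triple A₂ A₃ A₄ c₂))

mainTheorem16 : (L : Set) (C : L → L → L → Set) → IsLStructure L C →
                (c : L) (A : L → Set) (f : L → L) →
                LNotions.Universal C c A →
                LNotions.BehavesAsRer C c A f →
                LNotions.PreservesQOn C A f
mainTheorem16 L C isL c A f universal rer =
  Rerouting.preserves-Q isL c A f (proj₁ universal) rer
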